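{- The logic $\mathsf{iCC}:=\mathsf{ICK}\oplus(p>p)\oplus(((p>q)\wedge((p\wedge q)>r))\to(p>r))\oplus(((p>q)\wedge(p>r))\to((p\wedge q)>r))$ is sound and complete with respect to the class of cautious conditional frames, i.e. conditional Kripke frames $(X,\le,\mathcal R)$ such that for all $x\in X$ and all upsets $a,b$: $R_a[x]\subseteq a$, and if $R_a[x]\subseteq b\subseteq a$ then ${\uparrow}R_a[x]={\uparrow}R_b[x]$.
   Context: Formulas: $\phi::=p\mid\bot\mid\phi\wedge\phi\mid\phi\vee\phi\mid\phi\to\phi\mid\phi>\phi$, $\top:=\bot\to\bot$. $\mathsf{ICK}\oplus\Gamma$ is the smallest set of formulas containing the axioms of intuitionistic propositional logic, $\Gamma$, $(p>(q\wedge r))\leftrightarrow((p>q)\wedge(p>r))$ and $(p>\top)\leftrightarrow\top$, closed under uniform substitution, modus ponens and: from $\phi\leftrightarrow\psi$ infer $(\phi>\chi)\leftrightarrow(\psi>\chi)$ and $(\chi>\phi)\leftrightarrow(\chi>\psi)$. A conditional Kripke frame is $(X,\le,\mathcal R)$, $(X,\le)$ a nonempty preorder, $\mathcal R=\{R_a: a\text{ upset}\}$ such that $x\le yR_az$ implies $xR_aw\le z$ for some $w$; $R_a[x]=\{y:xR_ay\}$, ${\uparrow}S=\{y:\exists s\in S,\ s\le y\}$. Valuations map variables to upsets; intuitionistic Kripke clauses and $x\models\phi>\psi$ iff every $y$ with $xR_{V(\phi)}y$ satisfies $\psi$. Sound and complete: the logic's members are exactly the formulas valid on all frames in the class. -}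

module Defs where

open import Data.Nat using (ℕ)
open import Data.Empty using (⊥)
open import Data.Product using (Σ; _×_; ∃; _,_)
open import Data.Sum using (_⊎_)
open import Function.Bundles using (_⇔_)
open import Level using (0ℓ) renaming (suc to lsuc)

infixr 6 _∧'_
infixr 5 _∨'_
infixr 4 _⇒_
infixr 7 _▷_

data Formula : Set where
  var  : ℕ → Formula
  ⊥'   : Formula
  _∧'_ : Formula → Formula → Formula
  _∨'_ : Formula → Formula → Formula
  _⇒_  : Formula → Formula → Formula
  _▷_  : Formula → Formula → Formula

⊤' : Formula
⊤' = ⊥' ⇒ ⊥'

_⇔'_ : Formula → Formula → Formula
φ ⇔' ψ = (φ ⇒ ψ) ∧' (ψ ⇒ φ)

p q r : Formula
p = var 0
q = var 1
r = var 2

_[_] : Formula → (ℕ → Formula) → Formula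
var n    [ σ ] = σ n
⊥'       [ σ ] = ⊥'
(φ ∧' ψ) [ σ ] = (φ [ σ ]) ∧' (ψ [ σ ])
(φ ∨' ψ) [ σ ] = (φ [ σ ]) ∨' (ψ [ σ ])
(φ ⇒ ψ)  [ σ ] = (φ [ σ ]) ⇒ (ψ [ σ ])
(φ ▷ ψ)  [ σ ] = (φ [ σ ]) ▷ (ψ [ σ ])

data IPCAxiom : Formula → Set where
  axK  : IPCAxiom (p ⇒ q ⇒ p)
  axS  : IPCAxiom ((p ⇒ q ⇒ r) ⇒ (p ⇒ q) ⇒ p ⇒ r)
  ∧E₁  : IPCAxiom (p ∧' q ⇒ p)
  ∧E₂  : IPCAxiom (p ∧' q ⇒ q)
  ∧I   : IPCAxiom (p ⇒ q ⇒ p ∧' q)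
  ∨I₁  : IPCAxiom (p ⇒ p ∨' q)
  ∨I₂  : IPCAxiom (q ⇒ p ∨' q)
  ∨E   : IPCAxiom ((p ⇒ r) ⇒ (q ⇒ r) ⇒ p ∨' q ⇒ r)
  ⊥E   : IPCAxiom (⊥' ⇒ p)

data ICK⊕ (Γ : Formula → Set) : Formula → Set where
  ipc   : ∀ {φ} → IPCAxiom φ → ICK⊕ Γ φ
  extra : ∀ {φ} → Γ φ → ICK⊕ Γ φ
  ck∧   : ICK⊕ Γ ((p ▷ (q ∧' r)) ⇔' ((p ▷ q) ∧' (p ▷ r)))
  ck⊤   : ICK⊕ Γ ((p ▷ ⊤') ⇔' ⊤')
  usub  : ∀ {φ} (σ : ℕ → Formula) → ICK⊕ Γ φ → ICK⊕ Γ (φ [ σ ])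
  mp    : ∀ {φ ψ} → ICK⊕ Γ (φ ⇒ ψ) → ICK⊕ Γ φ → ICK⊕ Γ ψ
  congˡ : ∀ {φ ψ} (χ : Formula) → ICK⊕ Γ (φ ⇔' ψ) → ICK⊕ Γ ((φ ▷ χ) ⇔' (ψ ▷ χ))
  congʳ : ∀ {φ ψ} (χ : Formula) → ICK⊕ Γ (φ ⇔' ψ) → ICK⊕ Γ ((χ ▷ φ) ⇔' (χ ▷ ψ))

data iCCAxiom : Formula → Set where
  id▷  : iCCAxiom (p ▷ p)
  cut  : iCCAxiom (((p ▷ q) ∧' ((p ∧' q) ▷ r)) ⇒ (p ▷ r))
  cmon : iCCAxiom (((p ▷ q) ∧' (p ▷ r)) ⇒ ((p ∧' q) ▷ r))

iCC : Formula → Set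
iCC = ICK⊕ iCCAxiom

record Upset {X : Set} (_≤_ : X → X → Set) : Set₁ where
  field
    mem : X → Set
    up  : ∀ {x y} → x ≤ y → mem x → mem y
open Upset public

_⊆_ : {X : Set} → (X → Set) → (X → Set) → Set
A ⊆ B = ∀ y → A y → B y

record Frame : Set₁ where
  field
    X       : Set
    _≤_     : X → X → Set
    ≤-refl  : ∀ {x} → x ≤ x
    ≤-trans : ∀ {x y z} → x ≤ y → y ≤ z → x ≤ z
    point   : X
    R : Upset _≤_ → X → X → Set
    -- R is indexed by upsets as SETS: upsets with the same members
    -- have the same relation
    R-ext : ∀ (a b : Upset _≤_) → mem a ⊆ mem b → mem b ⊆ mem a →
            ∀ x y → R a x y → R b x y
    back  : ∀ (a : Upset _≤_) {x y z} → x ≤ y → R a y z →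
            Σ X λ w → R a x w × (w ≤ z)

  Up : Set₁
  Up = Upset _≤_

  Rset : Up → X → X → Set
  Rset a x = R a x

  ↑ : (X → Set) → X → Set
  ↑ S y = Σ X λ s → S s × (s ≤ y)

Cautious : Frame → Set₁
Cautious F = let open Frame F in
  (∀ (x : X) (a : Up) → Rset a x ⊆ mem a) ×
  (∀ (x : X) (a b : Up) → Rset a x ⊆ mem b → mem b ⊆ mem a →
     ∀ y → ↑ (Rset a x) y ⇔ ↑ (Rset b x) y)

module Semantics (F : Frame) where
  open Frame F

  Valuation : Set₁
  Valuation = ℕ → Up

  mutual
    _⊨_[_] : X → Formula → Valuation → Set
    x ⊨ var n    [ V ] = mem (V n) x
    x ⊨ ⊥'       [ V ] = ⊥
    x ⊨ (φ ∧' ψ) [ V ] = (x ⊨ φ [ V ]) × (x ⊨ ψ [ V ])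
    x ⊨ (φ ∨' ψ) [ V ] = (x ⊨ φ [ V ]) ⊎ (x ⊨ ψ [ V ])
    x ⊨ (φ ⇒ ψ)  [ V ] = ∀ y → x ≤ y → y ⊨ φ [ V ] → y ⊨ ψ [ V ]
    x ⊨ (φ ▷ ψ)  [ V ] = ∀ y → R (⟦ φ ⟧ V) x y → y ⊨ ψ [ V ]

    ⟦_⟧ : Formula → Valuation → Up
    ⟦ φ ⟧ V = record { mem = λ x → x ⊨ φ [ V ] ; up = persist φ V }

    persist : ∀ φ V {x y} → x ≤ y → x ⊨ φ [ V ] → y ⊨ φ [ V ]
    persist (var n)  V xy h = up (V n) xy h
    persist ⊥'       V xy ()
    persist (φ ∧' ψ) V xy (h₁ , h₂) = persist φ V xy h₁ , persist ψ V xy h₂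
    persist (φ ∨' ψ) V xy (Data.Sum.inj₁ h) = Data.Sum.inj₁ (persist φ V xy h)
    persist (φ ∨' ψ) V xy (Data.Sum.inj₂ h) = Data.Sum.inj₂ (persist ψ V xy h)
    persist (φ ⇒ ψ)  V xy h z yz hz = h z (≤-trans xy yz) hz
    persist (φ ▷ ψ)  V {x} {y} xy h z Ryz with back (⟦ φ ⟧ V) xy Ryz
    ... | w , Rxw , wz = persist ψ V wz (h w Rxw)

  Valid : Formula → Set₁
  Valid φ = ∀ (V : Valuation) (x : X) → x ⊨ φ [ V ]

Valid-on : Frame → Formula → Set₁
Valid-on F φ = Semantics.Valid F φ

module Submission where

-- Soundness is a direct check: cut and cautious monotonicity are the two directions of the second
-- cautious condition for b = ‖p ∧ q‖, squeezed between R_p[x] and ‖p‖ whenever x ⊨ p ▷ q.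
--
-- Completeness goes through the canonical model of prime theories (Lindenbaum's lemma uses
-- excluded middle). The frame must interpret R_a for every upset a, not only for truth sets.
-- Say φ defines a at Γ if all φ-successors of Γ lie in a and a ⊆ ‖φ‖. If some φ defines a at Γ,
-- let R_a[Γ] be the φ-successors of Γ; two defining formulas satisfy φ ▷ φ' and φ' ▷ φ, so by
-- cautious substitution of equivalents they give the same successors. Otherwise let R_a[Γ] = a.
-- Then R_a[Γ] ⊆ a, and a formula defining a also defines every b with R_a[Γ] ⊆ b ⊆ a, which
-- gives the cautious condition; the identity axiom φ ▷ φ makes φ define ‖φ‖ everywhere.

open import Defs
open import Level using (0ℓ)
open import Function.Base using (_∘_)
open import Function.Bundles using (_⇔_; mk⇔; Equivalence)
open import Function.Construct.Identity using (⇔-id)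
open import Function.Construct.Symmetry using (⇔-sym)
open import Function.Construct.Composition using (_⇔-∘_)
open import Axiom.ExcludedMiddle using (ExcludedMiddle)
open import Data.Nat using (ℕ; zero; suc; _⊔_; _≤′_; ≤′-refl; ≤′-step) renaming (_≤_ to _≤ℕ_)
open import Data.Nat.Properties using (m≤m⊔n; m≤n⊔m; ≤⇒≤′)
open import Data.Empty using (⊥; ⊥-elim)
open import Data.Bool using (Bool; T)
open import Data.Product using (Σ; _×_; _,_; proj₁; proj₂)
open import Data.Sum using (_⊎_; inj₁; inj₂)
open import Relation.Nullary using (¬_; Dec; yes; no)
open import Relation.Nullary.Decidable using (isYes; toWitness; fromWitness)
open import Relation.Binary.PropositionalEquality using (_≡_; refl)
open import Data.List using (List; []; _∷_; _++_; foldl; concatMap; cartesianProductWith)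
open import Data.List.Membership.Propositional using (_∈_)
open import Data.List.Membership.Propositional.Properties
  using (∈-++⁺ˡ; ∈-++⁺ʳ; ∈-concatMap⁺; ∈-cartesianProductWith⁺)
open import Data.List.Relation.Unary.Any as Any using (here; there)

open Equivalence

private
  variable
    a b c α β φ ψ χ : Formula
    Γ Θ : Formula → Set

-- Derivations

inst : Formula → Formula → Formula → ℕ → Formula
inst a b c 0 = a
inst a b c 1 = b
inst a b c 2 = c
inst a b c _ = ⊥'

⊢K : iCC (a ⇒ b ⇒ a)
⊢K {a} {b} = usub (inst a b ⊥') (ipc axK)

⊢S : iCC ((a ⇒ b ⇒ c) ⇒ (a ⇒ b) ⇒ a ⇒ c)
⊢S {a} {b} {c} = usub (inst a b c) (ipc axS)

⊢I : iCC (a ⇒ a)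
⊢I {a} = mp (mp (⊢S {b = a ⇒ a}) ⊢K) (⊢K {b = a})

⊢∧E₁ : iCC (a ∧' b ⇒ a)
⊢∧E₁ {a} {b} = usub (inst a b ⊥') (ipc ∧E₁)

⊢∧E₂ : iCC (a ∧' b ⇒ b)
⊢∧E₂ {a} {b} = usub (inst a b ⊥') (ipc ∧E₂)

⊢∧I : iCC (a ⇒ b ⇒ a ∧' b)
⊢∧I {a} {b} = usub (inst a b ⊥') (ipc ∧I)

⊢∨I₁ : iCC (a ⇒ a ∨' b)
⊢∨I₁ {a} {b} = usub (inst a b ⊥') (ipc ∨I₁)

⊢∨I₂ : iCC (b ⇒ a ∨' b)
⊢∨I₂ {b} {a} = usub (inst a b ⊥') (ipc ∨I₂)

⊢∨E : iCC ((a ⇒ c) ⇒ (b ⇒ c) ⇒ a ∨' b ⇒ c)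
⊢∨E {a} {c} {b} = usub (inst a b c) (ipc ∨E)

⊢⊥E : iCC (⊥' ⇒ a)
⊢⊥E {a} = usub (inst a ⊥' ⊥') (ipc ⊥E)

⊢▷∧ : iCC ((a ▷ (b ∧' c)) ⇔' ((a ▷ b) ∧' (a ▷ c)))
⊢▷∧ {a} {b} {c} = usub (inst a b c) ck∧

⊢▷⊤ : iCC ((a ▷ ⊤') ⇔' ⊤')
⊢▷⊤ {a} = usub (inst a ⊥' ⊥') ck⊤

⊢▷-refl : iCC (a ▷ a)
⊢▷-refl {a} = usub (inst a ⊥' ⊥') (extra id▷)

⊢▷-cut : iCC ((a ▷ b) ∧' ((a ∧' b) ▷ c) ⇒ (a ▷ c))
⊢▷-cut {a} {b} {c} = usub (inst a b c) (extra cut)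

⊢▷-cmon : iCC ((a ▷ b) ∧' (a ▷ c) ⇒ ((a ∧' b) ▷ c))
⊢▷-cmon {a} {b} {c} = usub (inst a b c) (extra cmon)

infix 3.5 _⊢_
infixl 5 _,,_

data _⊢_ (Γ : Formula → Set) : Formula → Set where
  thm : iCC φ → Γ ⊢ φ
  hyp : Γ φ → Γ ⊢ φ
  mp  : Γ ⊢ φ ⇒ ψ → Γ ⊢ φ → Γ ⊢ ψ

∅ : Formula → Set
∅ _ = ⊥

_,,_ : (Formula → Set) → Formula → Formula → Set
(Γ ,, χ) φ = Γ φ ⊎ φ ≡ χ

_⊆ˢ_ : (Formula → Set) → (Formula → Set) → Set
Γ ⊆ˢ Θ = ∀ {φ} → Γ φ → Θ φ

⊢-mono : Γ ⊆ˢ Θ → Γ ⊢ φ → Θ ⊢ φ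
⊢-mono Γ⊆Θ (thm t)  = thm t
⊢-mono Γ⊆Θ (hyp h)  = hyp (Γ⊆Θ h)
⊢-mono Γ⊆Θ (mp d e) = mp (⊢-mono Γ⊆Θ d) (⊢-mono Γ⊆Θ e)

∅⊢⇒iCC : ∅ ⊢ φ → iCC φ
∅⊢⇒iCC (thm t)  = t
∅⊢⇒iCC (mp d e) = mp (∅⊢⇒iCC d) (∅⊢⇒iCC e)

deduction : Γ ,, χ ⊢ ψ → Γ ⊢ χ ⇒ ψ
deduction (thm t)           = mp (thm ⊢K) (thm t)
deduction (hyp (inj₁ h))    = mp (thm ⊢K) (hyp h)
deduction (hyp (inj₂ refl)) = thm ⊢I
deduction (mp d e)          = mp (mp (thm ⊢S) (deduction d)) (deduction e)

assumption : Γ ,, χ ⊢ χ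
assumption = hyp (inj₂ refl)

weaken : Γ ⊢ φ → Γ ,, χ ⊢ φ
weaken = ⊢-mono inj₁

by : iCC (a ⇒ b) → Γ ⊢ a → Γ ⊢ b
by t d = mp (thm t) d

by₂ : iCC (a ⇒ b ⇒ c) → Γ ⊢ a → Γ ⊢ b → Γ ⊢ c
by₂ t d e = mp (mp (thm t) d) e

⇒-intro : ∅ ,, a ⊢ b → iCC (a ⇒ b)
⇒-intro = ∅⊢⇒iCC ∘ deduction

⇔-intro : iCC (a ⇒ b) → iCC (b ⇒ a) → iCC (a ⇔' b)
⇔-intro t u = mp (mp ⊢∧I t) u

⇔-elimˡ : iCC (a ⇔' b) → iCC (a ⇒ b)
⇔-elimˡ = mp ⊢∧E₁

⇔-elimʳ : iCC (a ⇔' b) → iCC (b ⇒ a)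
⇔-elimʳ = mp ⊢∧E₂

∧-comm : iCC (a ∧' b ⇒ b ∧' a)
∧-comm = ⇒-intro (by₂ ⊢∧I (by ⊢∧E₂ assumption) (by ⊢∧E₁ assumption))

▷-mono : iCC (α ⇒ β) → iCC ((φ ▷ α) ⇒ (φ ▷ β))
▷-mono {α} {β} {φ} t = ⇒-intro (by ⊢∧E₂ (by (⇔-elimˡ ⊢▷∧) (by (⇔-elimˡ α▷≡α∧β▷) assumption)))
  where
  α▷≡α∧β▷ : iCC ((φ ▷ α) ⇔' (φ ▷ (α ∧' β)))
  α▷≡α∧β▷ = congʳ φ (⇔-intro (⇒-intro (by₂ ⊢∧I assumption (by t assumption))) ⊢∧E₁)

▷-nec : iCC α → iCC (φ ▷ α)
▷-nec {α} t = mp (▷-mono (mp ⊢K t)) (mp (⇔-elimʳ ⊢▷⊤) ⊢I)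

▷-K : iCC ((φ ▷ (α ⇒ β)) ⇒ (φ ▷ α) ⇒ (φ ▷ β))
▷-K = ∅⊢⇒iCC (deduction (deduction
        (by (▷-mono modus-ponens) (by (⇔-elimʳ ⊢▷∧) (by₂ ⊢∧I (weaken assumption) assumption)))))
  where
  modus-ponens : iCC ((α ⇒ β) ∧' α ⇒ β)
  modus-ponens = ⇒-intro (mp (by ⊢∧E₁ assumption) (by ⊢∧E₂ assumption))

-- Cautious substitution of equivalents: the one consequence of cut and cautious monotonicity
-- that completeness needs.
▷-cso : Γ ⊢ φ ▷ ψ → Γ ⊢ ψ ▷ φ → Γ ⊢ φ ▷ χ → Γ ⊢ ψ ▷ χ
▷-cso {χ = χ} φ▷ψ ψ▷φ φ▷χ =
  by ⊢▷-cut (by₂ ⊢∧I ψ▷φ (by (⇔-elimˡ (congˡ χ (⇔-intro ∧-comm ∧-comm)))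
                            (by ⊢▷-cmon (by₂ ⊢∧I φ▷ψ φ▷χ))))

▷-consequence : (λ A → Γ ⊢ φ ▷ A) ⊢ ψ → Γ ⊢ φ ▷ ψ
▷-consequence (thm t)  = thm (▷-nec t)
▷-consequence (hyp h)  = h
▷-consequence (mp d e) = by₂ ▷-K (▷-consequence d) (▷-consequence e)

-- Soundness

module Soundness (F : Frame) (cautious : Cautious F) where
  open Frame F
  open Semantics F

  private
    R⊆ : ∀ x a → Rset a x ⊆ mem a
    R⊆ = proj₁ cautious

    ↑R-stable : ∀ x a b → Rset a x ⊆ mem b → mem b ⊆ mem a → ∀ y → ↑ (Rset a x) y ⇔ ↑ (Rset b x) y
    ↑R-stable = proj₂ cautious

  ⊨-subst : ∀ φ σ V x → (x ⊨ (φ [ σ ]) [ V ]) ⇔ (x ⊨ φ [ (λ n → ⟦ σ n ⟧ V) ])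
  ⊨-subst (var n) σ V x = ⇔-id _
  ⊨-subst ⊥' σ V x = ⇔-id _
  ⊨-subst (φ ∧' ψ) σ V x =
    mk⇔ (λ (s , t) → to (⊨-subst φ σ V x) s , to (⊨-subst ψ σ V x) t)
        (λ (s , t) → from (⊨-subst φ σ V x) s , from (⊨-subst ψ σ V x) t)
  ⊨-subst (φ ∨' ψ) σ V x =
    mk⇔ (Data.Sum.map (to (⊨-subst φ σ V x)) (to (⊨-subst ψ σ V x)))
        (Data.Sum.map (from (⊨-subst φ σ V x)) (from (⊨-subst ψ σ V x)))
  ⊨-subst (φ ⇒ ψ) σ V x =
    mk⇔ (λ h y x≤y s → to (⊨-subst ψ σ V y) (h y x≤y (from (⊨-subst φ σ V y) s)))
        (λ h y x≤y s → from (⊨-subst ψ σ V y) (h y x≤y (to (⊨-subst φ σ V y) s)))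
  ⊨-subst (φ ▷ ψ) σ V x =
    mk⇔ (λ h y xRy → to (⊨-subst ψ σ V y) (h y (R-ext _ _ φσ⊆φ φ⊆φσ x y xRy)))
        (λ h y xRy → from (⊨-subst ψ σ V y) (h y (R-ext _ _ φ⊆φσ φσ⊆φ x y xRy)))
    where
    φσ⊆φ : mem (⟦ φ ⟧ (λ n → ⟦ σ n ⟧ V)) ⊆ mem (⟦ φ [ σ ] ⟧ V)
    φσ⊆φ z = from (⊨-subst φ σ V z)
    φ⊆φσ : mem (⟦ φ [ σ ] ⟧ V) ⊆ mem (⟦ φ ⟧ (λ n → ⟦ σ n ⟧ V))
    φ⊆φσ z = to (⊨-subst φ σ V z)

  ipc-valid : IPCAxiom φ → Valid φ
  ipc-valid axK V x y _ s z y≤z _ = up (V 0) y≤z s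
  ipc-valid axS V x y _ h z y≤z g w z≤w s = h w (≤-trans y≤z z≤w) s w ≤-refl (g w z≤w s)
  ipc-valid ∧E₁ V x y _ (s , _) = s
  ipc-valid ∧E₂ V x y _ (_ , t) = t
  ipc-valid ∧I V x y _ s z y≤z t = up (V 0) y≤z s , t
  ipc-valid ∨I₁ V x y _ = inj₁
  ipc-valid ∨I₂ V x y _ = inj₂
  ipc-valid ∨E V x y _ f z y≤z g w z≤w (inj₁ s) = f w (≤-trans y≤z z≤w) s
  ipc-valid ∨E V x y _ f z y≤z g w z≤w (inj₂ t) = g w z≤w t
  ipc-valid ⊥E V x y _ ()

  -- If x ⊨ p ▷ q then R_p[x] ⊆ ‖p ∧ q‖ ⊆ ‖p‖, so the second cautious condition applies.
  ↑R-p∧q : ∀ V x → x ⊨ p ▷ q [ V ] → ∀ y → ↑ (Rset (⟦ p ⟧ V) x) y ⇔ ↑ (Rset (⟦ p ∧' q ⟧ V) x) y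
  ↑R-p∧q V x x⊨p▷q =
    ↑R-stable x (⟦ p ⟧ V) (⟦ p ∧' q ⟧ V) (λ y xRy → R⊆ x (⟦ p ⟧ V) y xRy , x⊨p▷q y xRy) (λ y → proj₁)

  iCC-valid : iCC φ → Valid φ
  iCC-valid (ipc ax) = ipc-valid ax
  iCC-valid (extra id▷) V x = R⊆ x (⟦ p ⟧ V)
  iCC-valid (extra cut) V x y _ (y⊨p▷q , y⊨p∧q▷r) z yRz
    with to (↑R-p∧q V y y⊨p▷q z) (z , yRz , ≤-refl)
  ... | w , yRw , w≤z = up (V 2) w≤z (y⊨p∧q▷r w yRw)
  iCC-valid (extra cmon) V x y _ (y⊨p▷q , y⊨p▷r) z yRz
    with from (↑R-p∧q V y y⊨p▷q z) (z , yRz , ≤-refl)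
  ... | w , yRw , w≤z = up (V 2) w≤z (y⊨p▷r w yRw)
  iCC-valid ck∧ V x =
    (λ y _ h → (λ z yRz → proj₁ (h z yRz)) , (λ z yRz → proj₂ (h z yRz))) ,
    (λ y _ h z yRz → proj₁ h z yRz , proj₂ h z yRz)
  iCC-valid ck⊤ V x = (λ _ _ _ _ _ t → t) , (λ _ _ _ _ _ _ _ t → t)
  iCC-valid (usub {φ} σ d) V x = from (⊨-subst φ σ V x) (iCC-valid d (λ n → ⟦ σ n ⟧ V) x)
  iCC-valid (mp d e) V x = iCC-valid d V x x ≤-refl (iCC-valid e V x)
  iCC-valid (congˡ {φ} {ψ} χ d) V x =
    (λ y _ h z yRz → h z (R-ext (⟦ ψ ⟧ V) (⟦ φ ⟧ V) ψ⊆φ φ⊆ψ y z yRz)) ,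
    (λ y _ h z yRz → h z (R-ext (⟦ φ ⟧ V) (⟦ ψ ⟧ V) φ⊆ψ ψ⊆φ y z yRz))
    where
    φ⊆ψ : mem (⟦ φ ⟧ V) ⊆ mem (⟦ ψ ⟧ V)
    φ⊆ψ z = proj₁ (iCC-valid d V z) z ≤-refl
    ψ⊆φ : mem (⟦ ψ ⟧ V) ⊆ mem (⟦ φ ⟧ V)
    ψ⊆φ z = proj₂ (iCC-valid d V z) z ≤-refl
  iCC-valid (congʳ χ d) V x =
    (λ y _ h z yRz → proj₁ (iCC-valid d V z) z ≤-refl (h z yRz)) ,
    (λ y _ h z yRz → proj₂ (iCC-valid d V z) z ≤-refl (h z yRz))

-- Enumeration of formulas

connectives : List (Formula → Formula → Formula)
connectives = _∧'_ ∷ _∨'_ ∷ _⇒_ ∷ _▷_ ∷ []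

selfProductWith : List Formula → (Formula → Formula → Formula) → List Formula
selfProductWith xs _∙_ = cartesianProductWith _∙_ xs xs

formulas : ℕ → List Formula
formulas zero    = ⊥' ∷ []
formulas (suc n) = formulas n ++ var n ∷ concatMap (selfProductWith (formulas n)) connectives

ℕ-upward : (P : ℕ → Set) → (∀ {n} → P n → P (suc n)) → ∀ {m n} → m ≤ℕ n → P m → P n
ℕ-upward P step m≤n = go (≤⇒≤′ m≤n)
  where
  go : ∀ {m n} → m ≤′ n → P m → P n
  go ≤′-refl       h = h
  go (≤′-step m≤n) h = step (go m≤n h)

formulas-mono : ∀ {m n} → m ≤ℕ n → φ ∈ formulas m → φ ∈ formulas n
formulas-mono {φ} = ℕ-upward (λ n → φ ∈ formulas n) ∈-++⁺ˡ

Enumerated : Formula → Set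
Enumerated φ = Σ ℕ λ n → φ ∈ formulas n

enumerated-∙ : ∀ {_∙_} → _∙_ ∈ connectives → Enumerated a → Enumerated b → Enumerated (a ∙ b)
enumerated-∙ {a} {b} {_∙_} ∙∈ (m , a∈) (n , b∈) =
  suc (m ⊔ n) , ∈-++⁺ʳ (formulas (m ⊔ n))
                  (there (∈-concatMap⁺ (selfProductWith (formulas (m ⊔ n))) (Any.map (λ { refl → a∙b∈ }) ∙∈)))
  where
  a∙b∈ : (a ∙ b) ∈ selfProductWith (formulas (m ⊔ n)) _∙_
  a∙b∈ = ∈-cartesianProductWith⁺ _∙_ (formulas-mono (m≤m⊔n m n) a∈) (formulas-mono (m≤n⊔m m n) b∈)

enumerate : ∀ φ → Enumerated φ
enumerate (var n)  = suc n , ∈-++⁺ʳ (formulas n) (here refl)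
enumerate ⊥'       = 0 , here refl
enumerate (a ∧' b) = enumerated-∙ (here refl) (enumerate a) (enumerate b)
enumerate (a ∨' b) = enumerated-∙ (there (here refl)) (enumerate a) (enumerate b)
enumerate (a ⇒ b)  = enumerated-∙ (there (there (here refl))) (enumerate a) (enumerate b)
enumerate (a ▷ b)  = enumerated-∙ (there (there (there (here refl)))) (enumerate a) (enumerate b)

-- Prime theories and the Lindenbaum lemma

-- Membership is Bool-valued so that prime theories form a Set, as the carrier of a frame must.
record PrimeTheory : Set where
  field
    member     : Formula → Bool
    closed     : (T ∘ member) ⊢ φ → T (member φ)
    prime      : T (member (a ∨' b)) → T (member a) ⊎ T (member b)
    consistent : ¬ T (member ⊥')

infix 4 _∈ₜ_
record _∈ₜ_ (φ : Formula) (Δ : PrimeTheory) : Set where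
  constructor ⟨_⟩
  field holds : T (PrimeTheory.member Δ φ)
open _∈ₜ_

closedₜ : ∀ Δ → (_∈ₜ Δ) ⊢ φ → φ ∈ₜ Δ
closedₜ Δ d = ⟨ PrimeTheory.closed Δ (⊢-mono holds d) ⟩

module Lindenbaum (em : ExcludedMiddle 0ℓ) (Γ₀ : Formula → Set) (ψ : Formula) (Γ₀⊬ψ : ¬ Γ₀ ⊢ ψ) where

  addIf : (Γ : Formula → Set) (χ : Formula) → Dec (Γ ,, χ ⊢ ψ) → Formula → Set
  addIf Γ χ (yes _) = Γ
  addIf Γ χ (no _)  = Γ ,, χ

  add : (Formula → Set) → Formula → Formula → Set
  add Γ χ = addIf Γ χ em

  addIf-⊇ : ∀ d → Γ ⊆ˢ addIf Γ χ d
  addIf-⊇ (yes _) = λ h → h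
  addIf-⊇ (no _)  = inj₁

  addIf-⊬ : ∀ d → ¬ Γ ⊢ ψ → ¬ addIf Γ χ d ⊢ ψ
  addIf-⊬ (yes _)   Γ⊬ψ = Γ⊬ψ
  addIf-⊬ (no Γχ⊬ψ) _   = Γχ⊬ψ

  addIf-decides : ∀ d → addIf Γ χ d χ ⊎ (Γ ,, χ ⊢ ψ)
  addIf-decides (yes Γχ⊢ψ) = inj₂ Γχ⊢ψ
  addIf-decides (no _)     = inj₁ (inj₂ refl)

  addAll-⊇ : ∀ xs → Γ ⊆ˢ foldl add Γ xs
  addAll-⊇ []       h = h
  addAll-⊇ (x ∷ xs) h = addAll-⊇ xs (addIf-⊇ em h)

  addAll-⊬ : ∀ xs → ¬ Γ ⊢ ψ → ¬ foldl add Γ xs ⊢ ψ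
  addAll-⊬ []       Γ⊬ψ = Γ⊬ψ
  addAll-⊬ (x ∷ xs) Γ⊬ψ = addAll-⊬ xs (addIf-⊬ em Γ⊬ψ)

  addAll-decides : ∀ xs → χ ∈ xs → foldl add Γ xs χ ⊎ (foldl add Γ xs ,, χ ⊢ ψ)
  addAll-decides (x ∷ xs) (there χ∈xs) = addAll-decides xs χ∈xs
  addAll-decides (x ∷ xs) (here refl) with addIf-decides em
  ... | inj₁ χ∈  = inj₁ (addAll-⊇ xs χ∈)
  ... | inj₂ Γχ⊢ψ = inj₂ (⊢-mono (Data.Sum.map₁ (addAll-⊇ xs ∘ addIf-⊇ em)) Γχ⊢ψ)

  stage : ℕ → Formula → Set
  stage zero    = Γ₀
  stage (suc n) = foldl add (stage n) (formulas n)

  stage-mono : ∀ {m n} → m ≤ℕ n → stage m ⊆ˢ stage n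
  stage-mono m≤n {φ} = ℕ-upward (λ n → stage n φ) (λ {n} → addAll-⊇ {Γ = stage n} (formulas n)) m≤n

  stage-⊬ : ∀ n → ¬ stage n ⊢ ψ
  stage-⊬ zero    = Γ₀⊬ψ
  stage-⊬ (suc n) = addAll-⊬ (formulas n) (stage-⊬ n)

  Δ : Formula → Set
  Δ φ = Σ ℕ λ n → stage n φ

  compact : Δ ⊢ φ → Σ ℕ λ n → stage n ⊢ φ
  compact (thm t)       = 0 , thm t
  compact (hyp (n , h)) = n , hyp h
  compact (mp d e) with compact d | compact e
  ... | m , d′ | n , e′ =
    m ⊔ n , mp (⊢-mono (stage-mono (m≤m⊔n m n)) d′) (⊢-mono (stage-mono (m≤n⊔m m n)) e′)

  Δ-⊬ : ¬ Δ ⊢ ψ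
  Δ-⊬ Δ⊢ψ = let n , stage⊢ψ = compact Δ⊢ψ in stage-⊬ n stage⊢ψ

  Δ-decides : ∀ χ → Δ χ ⊎ (Δ ,, χ ⊢ ψ)
  Δ-decides χ with enumerate χ
  ... | n , χ∈ with addAll-decides {Γ = stage n} (formulas n) χ∈
  ... | inj₁ χ∈stage = inj₁ (suc n , χ∈stage)
  ... | inj₂ stageχ⊢ψ = inj₂ (⊢-mono (Data.Sum.map₁ (suc n ,_)) stageχ⊢ψ)

  Δ-closed : Δ ⊢ χ → Δ χ
  Δ-closed {χ} Δ⊢χ with Δ-decides χ
  ... | inj₁ χ∈Δ  = χ∈Δ
  ... | inj₂ Δχ⊢ψ = ⊥-elim (Δ-⊬ (mp (deduction Δχ⊢ψ) Δ⊢χ))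

  Δ-prime : Δ (a ∨' b) → Δ a ⊎ Δ b
  Δ-prime {a} {b} a∨b∈Δ with Δ-decides a | Δ-decides b
  ... | inj₁ a∈Δ  | _         = inj₁ a∈Δ
  ... | inj₂ _    | inj₁ b∈Δ  = inj₂ b∈Δ
  ... | inj₂ Δa⊢ψ | inj₂ Δb⊢ψ =
    ⊥-elim (Δ-⊬ (mp (by₂ ⊢∨E (deduction Δa⊢ψ) (deduction Δb⊢ψ)) (hyp a∨b∈Δ)))

  theory : PrimeTheory
  theory = record
    { member     = λ φ → isYes (em {Δ φ})
    ; closed     = λ d → fromWitness (Δ-closed (⊢-mono toWitness d))
    ; prime      = Data.Sum.map fromWitness fromWitness ∘ Δ-prime ∘ toWitness
    ; consistent = λ ⊥∈Δ → Δ-⊬ (by ⊢⊥E (hyp (toWitness ⊥∈Δ)))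
    }

lindenbaum : ExcludedMiddle 0ℓ → ¬ Γ ⊢ ψ → Σ PrimeTheory λ Δ → (∀ {φ} → Γ φ → φ ∈ₜ Δ) × ¬ ψ ∈ₜ Δ
lindenbaum {Γ} {ψ} em Γ⊬ψ =
  theory , (λ φ∈Γ → ⟨ fromWitness (0 , φ∈Γ) ⟩) , (λ ψ∈Δ → Δ-⊬ (hyp (toWitness (holds ψ∈Δ))))
  where open Lindenbaum em Γ ψ Γ⊬ψ

-- The canonical cautious frame

module Canonical (em : ExcludedMiddle 0ℓ) where

  infix 4 _⊑_
  _⊑_ : PrimeTheory → PrimeTheory → Set
  Δ ⊑ Δ′ = ∀ {φ} → φ ∈ₜ Δ → φ ∈ₜ Δ′

  Successor : Formula → PrimeTheory → PrimeTheory → Set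
  Successor φ Γ Δ = ∀ {ψ} → (φ ▷ ψ) ∈ₜ Γ → ψ ∈ₜ Δ

  ▷-intro : ∀ Γ → (∀ Δ → Successor φ Γ Δ → ψ ∈ₜ Δ) → (φ ▷ ψ) ∈ₜ Γ
  ▷-intro {φ} {ψ} Γ succ⊆ψ with em {(φ ▷ ψ) ∈ₜ Γ}
  ... | yes φ▷ψ∈Γ = φ▷ψ∈Γ
  ... | no φ▷ψ∉Γ =
    let Δ , succ , ψ∉Δ = lindenbaum em (φ▷ψ∉Γ ∘ closedₜ Γ ∘ ▷-consequence ∘ ⊢-mono hyp)
    in ⊥-elim (ψ∉Δ (succ⊆ψ Δ succ))

  ⇒-introₜ : ∀ Δ → (∀ Θ → Δ ⊑ Θ → φ ∈ₜ Θ → ψ ∈ₜ Θ) → (φ ⇒ ψ) ∈ₜ Δ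
  ⇒-introₜ {φ} {ψ} Δ ↑φ⊆ψ with em {(φ ⇒ ψ) ∈ₜ Δ}
  ... | yes φ⇒ψ∈Δ = φ⇒ψ∈Δ
  ... | no φ⇒ψ∉Δ =
    let Θ , Δ,,φ⊆Θ , ψ∉Θ = lindenbaum em (φ⇒ψ∉Δ ∘ closedₜ Δ ∘ deduction)
    in ⊥-elim (ψ∉Θ (↑φ⊆ψ Θ (Δ,,φ⊆Θ ∘ inj₁) (Δ,,φ⊆Θ (inj₂ refl))))

  Upsetᶜ : Set₁
  Upsetᶜ = Upset _⊑_

  Defines : Upsetᶜ → PrimeTheory → Formula → Set
  Defines a Γ φ = (∀ Δ → Successor φ Γ Δ → mem a Δ) × (∀ Δ → mem a Δ → φ ∈ₜ Δ)

  Definable : Upsetᶜ → PrimeTheory → Set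
  Definable a Γ = Σ Formula (Defines a Γ)

  Rᶜ : Upsetᶜ → PrimeTheory → PrimeTheory → Set
  Rᶜ a Γ Δ = (Σ Formula λ φ → Defines a Γ φ × Successor φ Γ Δ) ⊎ (¬ Definable a Γ × mem a Δ)

  Defines-unique : ∀ a {Γ Δ φ φ′} → Defines a Γ φ → Defines a Γ φ′ → Successor φ Γ Δ → Successor φ′ Γ Δ
  Defines-unique a {Γ} (a⊇succφ , a⊆φ) (a⊇succφ′ , a⊆φ′) succφ φ′▷ψ∈Γ =
    succφ (closedₜ Γ (▷-cso (hyp φ′▷φ∈Γ) (hyp φ▷φ′∈Γ) (hyp φ′▷ψ∈Γ)))
    where
    φ▷φ′∈Γ = ▷-intro Γ (λ Δ succ → a⊆φ′ Δ (a⊇succφ Δ succ))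
    φ′▷φ∈Γ = ▷-intro Γ (λ Δ succ → a⊆φ Δ (a⊇succφ′ Δ succ))

  Defines-mono : ∀ a {Γ Γ′ φ} → Γ ⊑ Γ′ → Defines a Γ φ → Defines a Γ′ φ
  Defines-mono a Γ⊑Γ′ (a⊇succ , a⊆φ) = (λ Δ succ′ → a⊇succ Δ (succ′ ∘ Γ⊑Γ′)) , a⊆φ

  Defines-ext : ∀ a b {Γ φ} → mem a ⊆ mem b → mem b ⊆ mem a → Defines a Γ φ → Defines b Γ φ
  Defines-ext a b a⊆b b⊆a (a⊇succ , a⊆φ) =
    (λ Δ succ → a⊆b Δ (a⊇succ Δ succ)) , (λ Δ Δ∈b → a⊆φ Δ (b⊆a Δ Δ∈b))

  Rᶜ-defined : ∀ a {Γ Δ φ} → Defines a Γ φ → Rᶜ a Γ Δ ⇔ Successor φ Γ Δ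
  Rᶜ-defined a {Γ} {φ = φ} def = mk⇔ to′ (λ succ → inj₁ (φ , def , succ))
    where
    to′ : ∀ {Δ} → Rᶜ a Γ Δ → Successor φ Γ Δ
    to′ (inj₁ (φ′ , def′ , succ)) = Defines-unique a def′ def succ
    to′ (inj₂ (undef , _))        = ⊥-elim (undef (φ , def))

  Rᶜ-undefined : ∀ a {Γ Δ} → ¬ Definable a Γ → Rᶜ a Γ Δ ⇔ mem a Δ
  Rᶜ-undefined a {Γ} undef = mk⇔ to′ (λ Δ∈a → inj₂ (undef , Δ∈a))
    where
    to′ : ∀ {Δ} → Rᶜ a Γ Δ → mem a Δ
    to′ (inj₁ (φ , def , _)) = ⊥-elim (undef (φ , def))
    to′ (inj₂ (_ , Δ∈a))     = Δ∈a

  Rᶜ⊆ : ∀ Γ a → Rᶜ a Γ ⊆ mem a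
  Rᶜ⊆ Γ a Δ (inj₁ (φ , (a⊇succ , _) , succ)) = a⊇succ Δ succ
  Rᶜ⊆ Γ a Δ (inj₂ (_ , Δ∈a))                = Δ∈a

  Rᶜ-ext : ∀ (a b : Upsetᶜ) → mem a ⊆ mem b → mem b ⊆ mem a → ∀ Γ Δ → Rᶜ a Γ Δ → Rᶜ b Γ Δ
  Rᶜ-ext a b a⊆b b⊆a Γ Δ (inj₁ (φ , def , succ)) = inj₁ (φ , Defines-ext a b a⊆b b⊆a def , succ)
  Rᶜ-ext a b a⊆b b⊆a Γ Δ (inj₂ (undef , Δ∈a)) =
    inj₂ ((λ (φ , def) → undef (φ , Defines-ext b a b⊆a a⊆b def)) , a⊆b Δ Δ∈a)

  Rᶜ-antitone : ∀ a {Γ Γ′ Δ} → Γ ⊑ Γ′ → Rᶜ a Γ′ Δ → Rᶜ a Γ Δ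
  Rᶜ-antitone a {Γ} Γ⊑Γ′ (inj₁ (φ , def′ , succ′)) with em {Definable a Γ}
  ... | yes (φ″ , def) =
    inj₁ (φ″ , def , Defines-unique a def′ (Defines-mono a Γ⊑Γ′ def) succ′ ∘ Γ⊑Γ′)
  ... | no undef       = inj₂ (undef , proj₁ def′ _ succ′)
  Rᶜ-antitone a Γ⊑Γ′ (inj₂ (undef′ , Δ∈a)) =
    inj₂ ((λ (φ , def) → undef′ (φ , Defines-mono a Γ⊑Γ′ def)) , Δ∈a)

  Rᶜ-stable : ∀ Γ a b → Rᶜ a Γ ⊆ mem b → mem b ⊆ mem a → ∀ Δ → Rᶜ a Γ Δ ⇔ Rᶜ b Γ Δ
  Rᶜ-stable Γ a b Ra⊆b b⊆a Δ with em {Definable a Γ}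
  ... | yes (φ , defᵃ) = ⇔-sym (Rᶜ-defined b defᵇ) ⇔-∘ Rᶜ-defined a defᵃ
    where
    defᵇ : Defines b Γ φ
    defᵇ = (λ Δ′ succ → Ra⊆b Δ′ (from (Rᶜ-defined a defᵃ) succ))
         , (λ Δ′ Δ′∈b → proj₂ defᵃ Δ′ (b⊆a Δ′ Δ′∈b))
  ... | no undef = mk⇔ (Rᶜ-ext a b a⊆b b⊆a Γ Δ) (Rᶜ-ext b a b⊆a a⊆b Γ Δ)
    where
    a⊆b : mem a ⊆ mem b
    a⊆b Δ′ Δ′∈a = Ra⊆b Δ′ (from (Rᶜ-undefined a undef) Δ′∈a)

  frame : PrimeTheory → Frame
  frame point = record
    { X       = PrimeTheory
    ; _≤_     = _⊑_
    ; ≤-refl  = λ φ∈Δ → φ∈Δ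
    ; ≤-trans = λ Δ⊑Δ′ Δ′⊑Δ″ → Δ′⊑Δ″ ∘ Δ⊑Δ′
    ; point   = point
    ; R       = Rᶜ
    ; R-ext   = Rᶜ-ext
    ; back    = λ a {z = Δ} Γ⊑Γ′ Γ′RΔ → Δ , Rᶜ-antitone a Γ⊑Γ′ Γ′RΔ , (λ φ∈Δ → φ∈Δ)
    }

  frame-cautious : ∀ point → Cautious (frame point)
  frame-cautious point = Rᶜ⊆ , λ Γ a b Ra⊆b b⊆a Δ → ↑-cong (Rᶜ-stable Γ a b Ra⊆b b⊆a) Δ
    where
    open Frame (frame point) using (↑)
    ↑-cong : ∀ {A B : PrimeTheory → Set} → (∀ Δ → A Δ ⇔ B Δ) → ∀ Δ → ↑ A Δ ⇔ ↑ B Δ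
    ↑-cong A⇔B Δ = mk⇔ (λ (Θ , Θ∈A , Θ⊑Δ) → Θ , to (A⇔B Θ) Θ∈A , Θ⊑Δ)
                       (λ (Θ , Θ∈B , Θ⊑Δ) → Θ , from (A⇔B Θ) Θ∈B , Θ⊑Δ)

  module Truth (point : PrimeTheory) where
    open Semantics (frame point)

    Vᶜ : Valuation
    Vᶜ n = record { mem = var n ∈ₜ_ ; up = λ Δ⊑Δ′ → Δ⊑Δ′ }

    truth : ∀ φ Δ → (Δ ⊨ φ [ Vᶜ ]) ⇔ φ ∈ₜ Δ
    truth (var n) Δ = ⇔-id _
    truth ⊥' Δ = mk⇔ (λ ()) (PrimeTheory.consistent Δ ∘ holds)
    truth (φ ∧' ψ) Δ =
      mk⇔ (λ (Δ⊨φ , Δ⊨ψ) → closedₜ Δ (by₂ ⊢∧I (hyp (to (truth φ Δ) Δ⊨φ)) (hyp (to (truth ψ Δ) Δ⊨ψ))))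
          (λ φ∧ψ∈Δ → from (truth φ Δ) (closedₜ Δ (by ⊢∧E₁ (hyp φ∧ψ∈Δ)))
                   , from (truth ψ Δ) (closedₜ Δ (by ⊢∧E₂ (hyp φ∧ψ∈Δ))))
    truth (φ ∨' ψ) Δ = mk⇔ to′ from′
      where
      to′ : Δ ⊨ φ ∨' ψ [ Vᶜ ] → (φ ∨' ψ) ∈ₜ Δ
      to′ (inj₁ Δ⊨φ) = closedₜ Δ (by ⊢∨I₁ (hyp (to (truth φ Δ) Δ⊨φ)))
      to′ (inj₂ Δ⊨ψ) = closedₜ Δ (by ⊢∨I₂ (hyp (to (truth ψ Δ) Δ⊨ψ)))
      from′ : (φ ∨' ψ) ∈ₜ Δ → Δ ⊨ φ ∨' ψ [ Vᶜ ]
      from′ φ∨ψ∈Δ = Data.Sum.map (from (truth φ Δ) ∘ ⟨_⟩) (from (truth ψ Δ) ∘ ⟨_⟩)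
                                 (PrimeTheory.prime Δ (holds φ∨ψ∈Δ))
    truth (φ ⇒ ψ) Δ = mk⇔ to′ from′
      where
      to′ : Δ ⊨ φ ⇒ ψ [ Vᶜ ] → (φ ⇒ ψ) ∈ₜ Δ
      to′ Δ⊨φ⇒ψ = ⇒-introₜ Δ (λ Θ Δ⊑Θ φ∈Θ → to (truth ψ Θ) (Δ⊨φ⇒ψ Θ Δ⊑Θ (from (truth φ Θ) φ∈Θ)))
      from′ : (φ ⇒ ψ) ∈ₜ Δ → Δ ⊨ φ ⇒ ψ [ Vᶜ ]
      from′ φ⇒ψ∈Δ Θ Δ⊑Θ Θ⊨φ =
        from (truth ψ Θ) (closedₜ Θ (mp (hyp (Δ⊑Θ φ⇒ψ∈Δ)) (hyp (to (truth φ Θ) Θ⊨φ))))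
    truth (φ ▷ ψ) Γ = mk⇔ to′ from′
      where
      φ-defines : Defines (⟦ φ ⟧ Vᶜ) Γ φ
      φ-defines = (λ Δ succ → from (truth φ Δ) (succ (closedₜ Γ (thm ⊢▷-refl)))) , (λ Δ → to (truth φ Δ))
      to′ : Γ ⊨ φ ▷ ψ [ Vᶜ ] → (φ ▷ ψ) ∈ₜ Γ
      to′ Γ⊨φ▷ψ =
        ▷-intro Γ (λ Δ succ → to (truth ψ Δ) (Γ⊨φ▷ψ Δ (from (Rᶜ-defined (⟦ φ ⟧ Vᶜ) φ-defines) succ)))
      from′ : (φ ▷ ψ) ∈ₜ Γ → Γ ⊨ φ ▷ ψ [ Vᶜ ]
      from′ φ▷ψ∈Γ Δ ΓRΔ = from (truth ψ Δ) (to (Rᶜ-defined (⟦ φ ⟧ Vᶜ) φ-defines) ΓRΔ φ▷ψ∈Γ)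

completeness : ExcludedMiddle 0ℓ → (∀ F → Cautious F → Valid-on F φ) → iCC φ
completeness {φ} em valid with em {iCC φ}
... | yes ⊢φ = ⊢φ
... | no ⊬φ =
  let Δ , _ , φ∉Δ = lindenbaum {Γ = ∅} em (⊬φ ∘ ∅⊢⇒iCC)
      open Canonical em
      open Truth Δ
  in ⊥-elim (φ∉Δ (to (truth φ Δ) (valid (frame Δ) (frame-cautious Δ) Vᶜ Δ)))

theorem6p7 : ExcludedMiddle 0ℓ →
    ∀ (φ : Formula) → iCC φ ⇔ (∀ (F : Frame) → Cautious F → Valid-on F φ)
theorem6p7 em φ = mk⇔ (λ ⊢φ F cautious → Soundness.iCC-valid F cautious ⊢φ) (completeness em)
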